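{- Let $S,P$ be disjoint finite sets, $\mathcal{V}_{SP}$ a vector space on $S\uplus P$, and $L_P\subseteq\mathcal{V}_{SP}\circ P$ a number lattice with $\mathrm{span}(L_P)\supseteq\mathcal{V}_{SP}\times P$. Let $\mathcal{K}_S:=\mathcal{V}_{SP}\leftrightarrow L_P$. Then $\mathcal{K}_S=\mathcal{V}_{SP}\times S+L_S$, where $L_S$ is a number lattice orthogonal to $\mathcal{V}_{SP}\times S$.
   Context: Vectors are over $\mathbb{Q}$; $(f_S,f_P)$ is the vector on $S\uplus P$ formed from $f_S,f_P$. A number lattice is the set of integer linear combinations of finitely many vectors. Restriction $\mathcal{V}_{SP}\circ P=\{f_P:\exists f_S,(f_S,f_P)\in\mathcal{V}_{SP}\}$; contraction $\mathcal{V}_{SP}\times P=\{f_P:(0_S,f_P)\in\mathcal{V}_{SP}\}$ and $\mathcal{V}_{SP}\times S=\{f_S:(f_S,0_P)\in\mathcal{V}_{SP}\}$. Matched composition: $\mathcal{V}_{SP}\leftrightarrow L_P=\{f_S:\exists h_P\in L_P,(f_S,h_P)\in\mathcal{V}_{SP}\}$. -}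

module Defs where

open import Data.Nat using (ℕ; zero; suc)
open import Data.Fin using (Fin; zero; suc)
open import Data.Integer using (ℤ)
open import Data.Rational using (ℚ; 0ℚ; _+_; _*_; _/_)
open import Data.Product using (Σ; ∃; _×_; _,_)
open import Relation.Binary.PropositionalEquality using (_≡_)

-- A vector on a finite set of size n (the set is identified with Fin n).
QVec : ℕ → Set
QVec n = Fin n → ℚ

ΣFin : (k : ℕ) → (Fin k → ℚ) → ℚ
ΣFin zero    f = 0ℚ
ΣFin (suc k) f = f zero + ΣFin k (λ j → f (suc j))

_≋_ : {n : ℕ} → QVec n → QVec n → Set
f ≋ g = ∀ i → f i ≡ g i

_⊕_ : {n : ℕ} → QVec n → QVec n → QVec n
(f ⊕ g) i = f i + g i

dot : {n : ℕ} → QVec n → QVec n → ℚ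
dot {n} f g = ΣFin n (λ i → f i * g i)

comb : {n k : ℕ} → (Fin k → ℚ) → (Fin k → QVec n) → QVec n
comb {n} {k} c g i = ΣFin k (λ j → c j * g j i)

ℤ→ℚ : ℤ → ℚ
ℤ→ℚ z = z / 1

InSpan : {n k : ℕ} → (Fin k → QVec n) → QVec n → Set
InSpan {n} {k} g v = Σ (Fin k → ℚ) λ c → v ≋ comb c g

InLattice : {n k : ℕ} → (Fin k → QVec n) → QVec n → Set
InLattice {n} {k} g v = Σ (Fin k → ℤ) λ c → v ≋ comb (λ j → ℤ→ℚ (c j)) g

-- A vector space V_SP on S ⊎ P (|S| = s, |P| = p), given as the span of
-- k generators (gS j, gP j).  Every subspace of ℚ^(S⊎P) is of this form.
record VSpace (s p k : ℕ) : Set where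
  constructor vspace
  field
    genS : Fin k → QVec s
    genP : Fin k → QVec p

InV : {s p k : ℕ} → VSpace s p k → QVec s → QVec p → Set
InV {s} {p} {k} V fS fP =
  Σ (Fin k → ℚ) λ c → (fS ≋ comb c (VSpace.genS V)) × (fP ≋ comb c (VSpace.genP V))

zeroV : {n : ℕ} → QVec n
zeroV i = 0ℚ

InRestrP : {s p k : ℕ} → VSpace s p k → QVec p → Set
InRestrP {s} V fP = ∃ λ (fS : QVec s) → InV V fS fP

InContrP : {s p k : ℕ} → VSpace s p k → QVec p → Set
InContrP V fP = InV V zeroV fP

InContrS : {s p k : ℕ} → VSpace s p k → QVec s → Set
InContrS V fS = InV V fS zeroV

InMatched : {s p k m : ℕ} → VSpace s p k → (Fin m → QVec p) → QVec s → Set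
InMatched {s} {p} V lP fS = ∃ λ (hP : QVec p) → InLattice lP hP × InV V fS hP

module Submission where

-- Lift every generator ℓ_j of L_P to some (f_j , ℓ_j) ∈ V_SP.  An f ∈ K_S
-- matched with Σ c_j ℓ_j differs from Σ c_j f_j by an element of V_SP × S.
-- Subtracting from each f_j its orthogonal projection onto V_SP × S keeps the
-- lift in V_SP and makes it orthogonal to V_SP × S; L_S is generated by these
-- orthogonal lifts.

open import Defs
open import Algebra.Bundles using (Ring)
open import Data.Nat using (ℕ; zero; suc)
open import Data.Fin using (Fin; zero; suc)
open import Data.Integer using (ℤ; 0ℤ; 1ℤ)
open import Data.Rational using (ℚ; 0ℚ; 1ℚ; _+_; _*_; -_; _-_; _≤_; 1/_; ≢-nonZero)
open import Data.Rational.Base using (nonNegative; nonPositive)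
open import Data.Rational.Properties
open import Data.Product using (Σ; ∃; _×_; _,_; proj₁; proj₂)
open import Data.Sum using (inj₁; inj₂)
open import Relation.Nullary using (yes; no)
open import Relation.Binary.PropositionalEquality
open import Data.Vec.Functional.Relation.Binary.Equality.Setoid (setoid ℚ)
  using (≋-refl; ≋-sym; ≋-trans)
open import Algebra.Properties.Semiring.Sum (Ring.semiring +-*-ring)
  using (sum; sum-cong-≗; sum-replicate-zero; ∑-distrib-+; ∑-comm; *-distribˡ-sum; *-distribʳ-sum)
open import Algebra.Properties.Group +-0-group using (x∙y⁻¹≈ε⇒x≈y)
open import Data.Rational.Solver using (module +-*-Solver)
open +-*-Solver using (solve; _:+_; _:*_; _:-_; :-_; _:=_; con)

-- ΣFin is the library's sum over a functional vector, so the standard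
-- summation laws of a semiring transfer to it.
ΣFin≡sum : ∀ k (f : Fin k → ℚ) → ΣFin k f ≡ sum f
ΣFin≡sum zero    f = refl
ΣFin≡sum (suc k) f = cong (f zero +_) (ΣFin≡sum k (λ j → f (suc j)))

Σ-cong : ∀ k {f g : Fin k → ℚ} → (∀ j → f j ≡ g j) → ΣFin k f ≡ ΣFin k g
Σ-cong k {f} {g} f≗g = trans (ΣFin≡sum k f) (trans (sum-cong-≗ f≗g) (sym (ΣFin≡sum k g)))

Σ-zero : ∀ k → ΣFin k (λ _ → 0ℚ) ≡ 0ℚ
Σ-zero k = trans (ΣFin≡sum k _) (sum-replicate-zero k)

Σ-+ : ∀ k (f g : Fin k → ℚ) → ΣFin k (λ j → f j + g j) ≡ ΣFin k f + ΣFin k g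
Σ-+ k f g = trans (ΣFin≡sum k _)
  (trans (∑-distrib-+ f g) (sym (cong₂ _+_ (ΣFin≡sum k f) (ΣFin≡sum k g))))

Σ-*ˡ : ∀ k a (f : Fin k → ℚ) → ΣFin k (λ j → a * f j) ≡ a * ΣFin k f
Σ-*ˡ k a f = trans (ΣFin≡sum k _)
  (trans (sym (*-distribˡ-sum a f)) (cong (a *_) (sym (ΣFin≡sum k f))))

Σ-*ʳ : ∀ k a (f : Fin k → ℚ) → ΣFin k (λ j → f j * a) ≡ ΣFin k f * a
Σ-*ʳ k a f = trans (ΣFin≡sum k _)
  (trans (sym (*-distribʳ-sum a f)) (cong (_* a) (sym (ΣFin≡sum k f))))

Σ-swap : ∀ k l (f : Fin k → Fin l → ℚ) →
         ΣFin k (λ i → ΣFin l (f i)) ≡ ΣFin l (λ j → ΣFin k (λ i → f i j))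
Σ-swap k l f = trans (double k l f) (trans (∑-comm f) (sym (double l k (λ j i → f i j))))
  where
  double : ∀ k l (f : Fin k → Fin l → ℚ) → ΣFin k (λ i → ΣFin l (f i)) ≡ sum (λ i → sum (f i))
  double k l f = trans (Σ-cong k (λ i → ΣFin≡sum l (f i))) (ΣFin≡sum k _)

infixl 7 _·_
infixl 6 _⊖_

_·_ : ∀ {n} → ℚ → QVec n → QVec n
(a · f) i = a * f i

_⊖_ : ∀ {n} → QVec n → QVec n → QVec n
(f ⊖ g) i = f i - g i

dot-cong : ∀ {n} {f f′ g g′ : QVec n} → f ≋ f′ → g ≋ g′ → dot f g ≡ dot f′ g′
dot-cong {n} f≋ g≋ = Σ-cong n (λ i → cong₂ _*_ (f≋ i) (g≋ i))

dot-congʳ : ∀ {n} (f : QVec n) {g g′ : QVec n} → g ≋ g′ → dot f g ≡ dot f g′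
dot-congʳ f g≋ = dot-cong {f = f} ≋-refl g≋

dot-congˡ : ∀ {n} {f f′ : QVec n} → f ≋ f′ → (g : QVec n) → dot f g ≡ dot f′ g
dot-congˡ f≋ g = dot-cong {g = g} f≋ ≋-refl

dot-comm : ∀ {n} (f g : QVec n) → dot f g ≡ dot g f
dot-comm {n} f g = Σ-cong n (λ i → *-comm (f i) (g i))

dot-⊕ˡ : ∀ {n} (f g h : QVec n) → dot (f ⊕ g) h ≡ dot f h + dot g h
dot-⊕ˡ {n} f g h = trans (Σ-cong n (λ i → *-distribʳ-+ (h i) (f i) (g i))) (Σ-+ n _ _)

dot-·ˡ : ∀ {n} a (f h : QVec n) → dot (a · f) h ≡ a * dot f h
dot-·ˡ {n} a f h = trans (Σ-cong n (λ i → *-assoc a (f i) (h i))) (Σ-*ˡ n a _)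

-- A difference is a sum with a (−1)-multiple.
dot-⊖ˡ : ∀ {n} (f g h : QVec n) → dot (f ⊖ g) h ≡ dot f h - dot g h
dot-⊖ˡ f g h = begin
  dot (f ⊖ g) h                ≡⟨ dot-congˡ (λ i → minus-as-sum (f i) (g i)) h ⟩
  dot (f ⊕ (- 1ℚ · g)) h       ≡⟨ dot-⊕ˡ f (- 1ℚ · g) h ⟩
  dot f h + dot (- 1ℚ · g) h   ≡⟨ cong (dot f h +_) (dot-·ˡ (- 1ℚ) g h) ⟩
  dot f h + - 1ℚ * dot g h     ≡⟨ minus-as-sum (dot f h) (dot g h) ⟨
  dot f h - dot g h            ∎
  where
  open ≡-Reasoning
  minus-as-sum : ∀ a b → a - b ≡ a + - 1ℚ * b
  minus-as-sum = solve 2 (λ a b → a :- b := a :+ (:- con 1ℚ) :* b) refl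

dot-⊖ʳ : ∀ {n} (f g h : QVec n) → dot f (g ⊖ h) ≡ dot f g - dot f h
dot-⊖ʳ f g h = trans (dot-comm f (g ⊖ h))
  (trans (dot-⊖ˡ g h f) (cong₂ _-_ (dot-comm g f) (dot-comm h f)))

dot-zeroʳ : ∀ {n} (f g : QVec n) → g ≋ zeroV → dot f g ≡ 0ℚ
dot-zeroʳ {n} f g g≋0 = trans (Σ-cong n (λ i → trans (cong (f i *_) (g≋0 i)) (*-zeroʳ (f i))))
  (Σ-zero n)

-- Associativity of the matrix product eᵀ (C v) = (eᵀ C) v, written with dots.
dot-swap : ∀ {t n} (e : QVec t) (C : Fin t → QVec n) (v : QVec n) →
           dot e (λ j → dot (C j) v) ≡ dot (λ l → dot e (λ j → C j l)) v
dot-swap {t} {n} e C v = begin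
  ΣFin t (λ j → e j * ΣFin n (λ l → C j l * v l))     ≡⟨ Σ-cong t (λ j → Σ-*ˡ n (e j) _) ⟨
  ΣFin t (λ j → ΣFin n (λ l → e j * (C j l * v l)))   ≡⟨ Σ-swap t n _ ⟩
  ΣFin n (λ l → ΣFin t (λ j → e j * (C j l * v l)))   ≡⟨ Σ-cong n (λ l → Σ-cong t (λ j → *-assoc (e j) (C j l) (v l))) ⟨
  ΣFin n (λ l → ΣFin t (λ j → e j * C j l * v l))     ≡⟨ Σ-cong n (λ l → Σ-*ʳ t (v l) _) ⟩
  ΣFin n (λ l → ΣFin t (λ j → e j * C j l) * v l)     ∎
  where open ≡-Reasoning

δℤ : ∀ {k} → Fin k → Fin k → ℤ
δℤ zero    zero    = 1ℤ
δℤ zero    (suc _) = 0ℤ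
δℤ (suc _) zero    = 0ℤ
δℤ (suc i) (suc j) = δℤ i j

δ : ∀ {k} → Fin k → QVec k
δ i j = ℤ→ℚ (δℤ i j)

δ-sym : ∀ {k} (i j : Fin k) → δ i j ≡ δ j i
δ-sym zero    zero    = refl
δ-sym zero    (suc _) = refl
δ-sym (suc _) zero    = refl
δ-sym (suc i) (suc j) = δ-sym i j

dot-δ : ∀ {k} (i : Fin k) (f : QVec k) → dot (δ i) f ≡ f i
dot-δ {suc k} zero f =
  trans (cong₂ _+_ (*-identityˡ (f zero)) rest≡0) (+-identityʳ (f zero))
  where
  f′ : QVec k
  f′ j = f (suc j)
  rest≡0 : dot (λ j → δ zero (suc j)) f′ ≡ 0ℚ
  rest≡0 = trans (dot-comm (λ j → δ zero (suc j)) f′) (dot-zeroʳ f′ (λ j → δ zero (suc j)) (λ _ → refl))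
dot-δ {suc k} (suc i) f =
  trans (cong₂ _+_ (*-zeroˡ (f zero)) (dot-δ i (λ j → f (suc j)))) (+-identityˡ (f (suc i)))

-- Linear combinations.  Entry i of comb c g is the dot product of the
-- coefficients c with the i-th column (λ j → g j i), so every law below is a
-- law of the dot product.
comb-congᶠ : ∀ {n k} (c : QVec k) {g h : Fin k → QVec n} → (∀ j → g j ≋ h j) → comb c g ≋ comb c h
comb-congᶠ c g≋h i = dot-congʳ c (λ j → g≋h j i)

comb-congᶜ : ∀ {n k} {c d : QVec k} → c ≋ d → (g : Fin k → QVec n) → comb c g ≋ comb d g
comb-congᶜ c≋d g i = dot-congˡ c≋d (λ j → g j i)

comb-⊕ : ∀ {n k} (c d : QVec k) (g : Fin k → QVec n) → comb (c ⊕ d) g ≋ (comb c g ⊕ comb d g)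
comb-⊕ c d g i = dot-⊕ˡ c d (λ j → g j i)

comb-· : ∀ {n k} a (c : QVec k) (g : Fin k → QVec n) → comb (a · c) g ≋ (a · comb c g)
comb-· a c g i = dot-·ˡ a c (λ j → g j i)

comb-⊖ : ∀ {n k} (c d : QVec k) (g : Fin k → QVec n) → comb (c ⊖ d) g ≋ (comb c g ⊖ comb d g)
comb-⊖ c d g i = dot-⊖ˡ c d (λ j → g j i)

comb-⊖ᶠ : ∀ {n k} (c : QVec k) (g h : Fin k → QVec n) →
          comb c (λ j → g j ⊖ h j) ≋ (comb c g ⊖ comb c h)
comb-⊖ᶠ c g h i = dot-⊖ʳ c (λ j → g j i) (λ j → h j i)

comb-zeroᶠ : ∀ {n k} (c : QVec k) (g : Fin k → QVec n) → (∀ j → g j ≋ zeroV) → comb c g ≋ zeroV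
comb-zeroᶠ c g g≋0 i = dot-zeroʳ c (λ j → g j i) (λ j → g≋0 j i)

comb-comb : ∀ {n t k} (e : QVec t) (C : Fin t → QVec k) (g : Fin k → QVec n) →
            comb e (λ j → comb (C j) g) ≋ comb (comb e C) g
comb-comb e C g i = dot-swap e C (λ l → g l i)

comb-δ : ∀ {n k} (j : Fin k) (g : Fin k → QVec n) → comb (δ j) g ≋ g j
comb-δ j g i = dot-δ j (λ l → g l i)

comb-units : ∀ {k} (c : QVec k) → comb c δ ≋ c
comb-units c i = trans (dot-congʳ c (λ j → δ-sym j i)) (trans (dot-comm c (δ i)) (dot-δ i c))

⊥-comb : ∀ {n r} (x : QVec n) (u : Fin r → QVec n) →
         (∀ j → dot x (u j) ≡ 0ℚ) → ∀ d → dot x (comb d u) ≡ 0ℚ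
⊥-comb x u x⊥u d = begin
  dot x (comb d u)                      ≡⟨ dot-congʳ x (λ i → dot-comm d (λ j → u j i)) ⟩
  dot x (λ i → dot (λ j → u j i) d)     ≡⟨ dot-swap x (λ i j → u j i) d ⟩
  dot (λ j → dot x (u j)) d             ≡⟨ dot-comm _ d ⟩
  dot d (λ j → dot x (u j))             ≡⟨ dot-zeroʳ d _ x⊥u ⟩
  0ℚ                                    ∎
  where open ≡-Reasoning

comb-⊥ : ∀ {n r} (u : Fin r → QVec n) (x : QVec n) →
         (∀ j → dot (u j) x ≡ 0ℚ) → ∀ d → dot (comb d u) x ≡ 0ℚ
comb-⊥ u x u⊥x d = trans (dot-comm (comb d u) x) (⊥-comb x u (λ j → trans (dot-comm x (u j)) (u⊥x j)) d)

⊥-span : ∀ {n r} (x : QVec n) (u : Fin r → QVec n) {w : QVec n} →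
         (∀ j → dot x (u j) ≡ 0ℚ) → InSpan u w → dot x w ≡ 0ℚ
⊥-span x u x⊥u (d , w≋) = trans (dot-congʳ x w≋) (⊥-comb x u x⊥u d)

module _ {n r} (u : Fin r → QVec n) where

  InSpan-⊕ : ∀ {x y} → InSpan u x → InSpan u y → InSpan u (x ⊕ y)
  InSpan-⊕ (c , x≋) (d , y≋) = c ⊕ d , λ i → trans (cong₂ _+_ (x≋ i) (y≋ i)) (sym (comb-⊕ c d u i))

  InSpan-⊖ : ∀ {x y} → InSpan u x → InSpan u y → InSpan u (x ⊖ y)
  InSpan-⊖ (c , x≋) (d , y≋) = c ⊖ d , λ i → trans (cong₂ _-_ (x≋ i) (y≋ i)) (sym (comb-⊖ c d u i))

  InSpan-· : ∀ {x} a → InSpan u x → InSpan u (a · x)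
  InSpan-· a (c , x≋) = a · c , λ i → trans (cong (a *_) (x≋ i)) (sym (comb-· a c u i))

  InSpan-comb : ∀ {t} (w : Fin t → QVec n) → (∀ j → InSpan u (w j)) → ∀ e → InSpan u (comb e w)
  InSpan-comb {t} w w∈ e = comb e C , ≋-trans (comb-congᶠ e (λ j → proj₂ (w∈ j))) (comb-comb e C u)
    where
    C : Fin t → QVec r
    C j = proj₁ (w∈ j)

module _ {n r} (u : Fin (suc r) → QVec n) where

  InSpan-head : InSpan u (u zero)
  InSpan-head = δ zero , ≋-sym (comb-δ zero u)

  InSpan-tail : ∀ {x} → InSpan (λ j → u (suc j)) x → InSpan u x
  InSpan-tail {x} (c , x≋) = c₀ , λ i → begin
    x i                                      ≡⟨ x≋ i ⟩
    comb c u′ i                              ≡⟨ +-identityˡ _ ⟨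
    0ℚ + comb c u′ i                         ≡⟨ cong (_+ comb c u′ i) (*-zeroˡ (u zero i)) ⟨
    0ℚ * u zero i + comb c u′ i              ∎
    where
    open ≡-Reasoning
    u′ : Fin r → QVec n
    u′ j = u (suc j)
    c₀ : QVec (suc r)
    c₀ zero    = 0ℚ
    c₀ (suc j) = c j

square-nonneg : ∀ q → 0ℚ ≤ q * q
square-nonneg q with ≤-total 0ℚ q
... | inj₁ 0≤q = let instance _ = nonNegative 0≤q in nonNegative⁻¹ (q * q) {{nonNeg*nonNeg⇒nonNeg q q}}
... | inj₂ q≤0 = let instance _ = nonPositive q≤0 in nonNegative⁻¹ (q * q) {{nonPos*nonPos⇒nonPos q q}}

square-zero : ∀ q → q * q ≡ 0ℚ → q ≡ 0ℚ
square-zero q q²≡0 with q ≟ 0ℚ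
... | yes q≡0 = q≡0
... | no  q≢0 = let instance _ = ≢-nonZero q≢0 in begin
  q                ≡⟨ *-identityʳ q ⟨
  q * 1ℚ           ≡⟨ cong (q *_) (*-inverseʳ q) ⟨
  q * (q * 1/ q)   ≡⟨ *-assoc q q (1/ q) ⟨
  q * q * 1/ q     ≡⟨ cong (_* 1/ q) q²≡0 ⟩
  0ℚ * 1/ q        ≡⟨ *-zeroˡ (1/ q) ⟩
  0ℚ               ∎
  where open ≡-Reasoning

nonneg-sum-zero : ∀ {a b} → 0ℚ ≤ a → 0ℚ ≤ b → a + b ≡ 0ℚ → a ≡ 0ℚ × b ≡ 0ℚ
nonneg-sum-zero {a} {b} 0≤a 0≤b a+b≡0 = a≡0 , trans (sym (+-identityˡ b)) (trans (cong (_+ b) (sym a≡0)) a+b≡0)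
  where
  a≡0 : a ≡ 0ℚ
  a≡0 = ≤-antisym (subst₂ _≤_ (+-identityʳ a) a+b≡0 (+-mono-≤ (≤-refl {a}) 0≤b)) 0≤a

dot-self-nonneg : ∀ {n} (z : QVec n) → 0ℚ ≤ dot z z
dot-self-nonneg {zero}  z = ≤-refl
dot-self-nonneg {suc n} z =
  subst (_≤ dot z z) (+-identityʳ 0ℚ) (+-mono-≤ (square-nonneg (z zero)) (dot-self-nonneg (λ j → z (suc j))))

dot-self-zero : ∀ {n} (z : QVec n) → dot z z ≡ 0ℚ → z ≋ zeroV
dot-self-zero {suc n} z zz≡0 i
  with nonneg-sum-zero (square-nonneg (z zero)) (dot-self-nonneg (λ j → z (suc j))) zz≡0
dot-self-zero z zz≡0 zero    | head≡0 , _       = square-zero (z zero) head≡0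
dot-self-zero z zz≡0 (suc i) | _       , tail≡0 = dot-self-zero (λ j → z (suc j)) tail≡0 i

multiple-of : ∀ a b → (b ≡ 0ℚ → a ≡ 0ℚ) → Σ ℚ λ α → a - α * b ≡ 0ℚ
multiple-of a b b≡0⇒a≡0 with b ≟ 0ℚ
... | yes b≡0 = 0ℚ , trans (cong₂ _-_ (b≡0⇒a≡0 b≡0) (*-zeroˡ b)) (+-inverseʳ 0ℚ)
... | no  b≢0 = let instance _ = ≢-nonZero b≢0 in
  a * 1/ b , trans (cong (_-_ a) (trans (*-assoc a (1/ b) b) (trans (cong (a *_) (*-inverseˡ b)) (*-identityʳ a))))
                   (+-inverseʳ a)

-- For u = u₀ ∷ u′, project u₀ and x onto span u′,
-- giving residuals z and x′, and remove from x′ its component along z.  The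
-- coefficient of z exists even when z = 0, by positive definiteness.
project : ∀ {n r} (u : Fin r → QVec n) (x : QVec n) →
          Σ (QVec n) λ w → InSpan u w × (∀ j → dot (x ⊖ w) (u j) ≡ 0ℚ)
project {r = zero}  u x = zeroV , ((λ ()) , λ _ → refl) , λ ()
project {n} {suc r} u x
  with project (λ j → u (suc j)) (u zero) | project (λ j → u (suc j)) x
... | w₀ , w₀∈ , z⊥u′ | w₁ , w₁∈ , x′⊥u′ =
  w₁ ⊕ (α · z) , w∈ , residual⊥
  where
  open ≡-Reasoning
  u′ : Fin r → QVec n
  u′ j = u (suc j)
  z x′ : QVec n
  z  = u zero ⊖ w₀
  x′ = x ⊖ w₁
  α-spec : Σ ℚ λ α → dot x′ z - α * dot z z ≡ 0ℚ
  α-spec = multiple-of (dot x′ z) (dot z z) (λ zz≡0 → dot-zeroʳ x′ z (dot-self-zero z zz≡0))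
  α : ℚ
  α = proj₁ α-spec
  y : QVec n
  y = x′ ⊖ (α · z)

  w∈ : InSpan u (w₁ ⊕ (α · z))
  w∈ = InSpan-⊕ u (InSpan-tail u w₁∈) (InSpan-· u α (InSpan-⊖ u (InSpan-head u) (InSpan-tail u w₀∈)))

  dot-y : ∀ v → dot y v ≡ dot x′ v - α * dot z v
  dot-y v = trans (dot-⊖ˡ x′ (α · z) v) (cong (_-_ (dot x′ v)) (dot-·ˡ α z v))

  y⊥u′ : ∀ j → dot y (u′ j) ≡ 0ℚ
  y⊥u′ j = begin
    dot y (u′ j)                        ≡⟨ dot-y (u′ j) ⟩
    dot x′ (u′ j) - α * dot z (u′ j)    ≡⟨ cong₂ (λ a b → a - α * b) (x′⊥u′ j) (z⊥u′ j) ⟩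
    0ℚ - α * 0ℚ                         ≡⟨ cong (_-_ 0ℚ) (*-zeroʳ α) ⟩
    0ℚ                                  ∎

  -- u₀ = z + w₀ with w₀ ∈ span u′, and y ⊥ z by the choice of α.
  u₀≋z⊕w₀ : u zero ≋ (z ⊕ w₀)
  u₀≋z⊕w₀ i = solve 2 (λ a b → a := (a :- b) :+ b) refl (u zero i) (w₀ i)

  y⊥u₀ : dot y (u zero) ≡ 0ℚ
  y⊥u₀ = begin
    dot y (u zero)       ≡⟨ trans (dot-congʳ y u₀≋z⊕w₀) (dot-comm y (z ⊕ w₀)) ⟩
    dot (z ⊕ w₀) y       ≡⟨ dot-⊕ˡ z w₀ y ⟩
    dot z y + dot w₀ y   ≡⟨ cong₂ _+_ (trans (dot-comm z y) (trans (dot-y z) (proj₂ α-spec)))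
                                      (trans (dot-comm w₀ y) (⊥-span y u′ y⊥u′ w₀∈)) ⟩
    0ℚ + 0ℚ              ≡⟨⟩
    0ℚ                   ∎

  residual≋y : (x ⊖ (w₁ ⊕ (α · z))) ≋ y
  residual≋y i = solve 4 (λ X W Z A → X :- (W :+ A :* Z) := (X :- W) :- A :* Z) refl (x i) (w₁ i) (z i) α

  residual⊥ : ∀ j → dot (x ⊖ (w₁ ⊕ (α · z))) (u j) ≡ 0ℚ
  residual⊥ zero    = trans (dot-congˡ residual≋y (u zero)) y⊥u₀
  residual⊥ (suc j) = trans (dot-congˡ residual≋y (u′ j)) (y⊥u′ j)

-- The orthogonal complement of span R in ℚᵏ is spanned by the residuals
-- ρ j = δ j − proj(δ j) of the unit vectors: each ρ j is orthogonal to R,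
-- and a c orthogonal to R equals Σ c j ρ j, because c − Σ c j ρ j =
-- Σ c j proj(δ j) lies in span R and is orthogonal to R, hence is zero.
complement : ∀ {k p} (R : Fin p → QVec k) → Σ (Fin k → QVec k) λ ρ →
             (∀ j q → dot (ρ j) (R q) ≡ 0ℚ)
             × (∀ c → (∀ q → dot c (R q) ≡ 0ℚ) → c ≋ comb c ρ)
complement {k} R = ρ , ρ⊥R , ρ-spans
  where
  w : Fin k → QVec k
  w j = proj₁ (project R (δ j))

  ρ : Fin k → QVec k
  ρ j = δ j ⊖ w j

  ρ⊥R : ∀ j q → dot (ρ j) (R q) ≡ 0ℚ
  ρ⊥R j = proj₂ (proj₂ (project R (δ j)))

  ρ-spans : ∀ c → (∀ q → dot c (R q) ≡ 0ℚ) → c ≋ comb c ρ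
  ρ-spans c c⊥R i = x∙y⁻¹≈ε⇒x≈y (c i) (comb c ρ i) (dot-self-zero d d⊥d i)
    where
    d : QVec k
    d = c ⊖ comb c ρ

    d≋ : d ≋ comb c w
    d≋ i = begin
      c i - comb c ρ i                   ≡⟨ cong (_-_ (c i)) (comb-⊖ᶠ c δ w i) ⟩
      c i - (comb c δ i - comb c w i)    ≡⟨ cong (λ a → c i - (a - comb c w i)) (comb-units c i) ⟩
      c i - (c i - comb c w i)           ≡⟨ solve 2 (λ a b → a :- (a :- b) := b) refl (c i) (comb c w i) ⟩
      comb c w i                         ∎
      where open ≡-Reasoning

    d∈ : InSpan R d
    d∈ = let (e , e≋) = InSpan-comb R w (λ j → proj₁ (proj₂ (project R (δ j)))) c
         in e , ≋-trans d≋ e≋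

    d⊥R : ∀ q → dot d (R q) ≡ 0ℚ
    d⊥R q = trans (dot-⊖ˡ c (comb c ρ) (R q))
                  (cong₂ _-_ (c⊥R q) (comb-⊥ ρ (R q) (λ j → ρ⊥R j q) c))

    d⊥d : dot d d ≡ 0ℚ
    d⊥d = ⊥-span d R d⊥R d∈

module _ {s p k : ℕ} (V : VSpace s p k) where
  open VSpace V

  InV-cong : ∀ {x x′ y y′} → x ≋ x′ → y ≋ y′ → InV V x y → InV V x′ y′
  InV-cong x≋ y≋ (c , x≋S , y≋P) = c , ≋-trans (≋-sym x≋) x≋S , ≋-trans (≋-sym y≋) y≋P

  InV-⊕ : ∀ {x y x′ y′} → InV V x y → InV V x′ y′ → InV V (x ⊕ x′) (y ⊕ y′)
  InV-⊕ (c , x≋ , y≋) (c′ , x′≋ , y′≋) =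
    c ⊕ c′ , (λ i → trans (cong₂ _+_ (x≋ i) (x′≋ i)) (sym (comb-⊕ c c′ genS i)))
           , (λ i → trans (cong₂ _+_ (y≋ i) (y′≋ i)) (sym (comb-⊕ c c′ genP i)))

  InV-⊖ : ∀ {x y x′ y′} → InV V x y → InV V x′ y′ → InV V (x ⊖ x′) (y ⊖ y′)
  InV-⊖ (c , x≋ , y≋) (c′ , x′≋ , y′≋) =
    c ⊖ c′ , (λ i → trans (cong₂ _-_ (x≋ i) (x′≋ i)) (sym (comb-⊖ c c′ genS i)))
           , (λ i → trans (cong₂ _-_ (y≋ i) (y′≋ i)) (sym (comb-⊖ c c′ genP i)))

  InV-comb : ∀ {t} (xs : Fin t → QVec s) (ys : Fin t → QVec p) →
             (∀ j → InV V (xs j) (ys j)) → ∀ e → InV V (comb e xs) (comb e ys)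
  InV-comb {t} xs ys xy∈ e =
    comb e C , ≋-trans (comb-congᶠ e (λ j → proj₁ (proj₂ (xy∈ j)))) (comb-comb e C genS)
             , ≋-trans (comb-congᶠ e (λ j → proj₂ (proj₂ (xy∈ j)))) (comb-comb e C genP)
    where
    C : Fin t → QVec k
    C j = proj₁ (xy∈ j)

  InContrS-span : ∀ {t} (u : Fin t → QVec s) → (∀ i → InContrS V (u i)) →
                  ∀ {y} → InSpan u y → InContrS V y
  InContrS-span u u∈ (d , y≋) =
    InV-cong (≋-sym y≋) (comb-zeroᶠ d (λ _ → zeroV) (λ _ _ → refl)) (InV-comb u (λ _ → zeroV) u∈ d)

  -- Its elements are the combinations
  -- Σ c j · genS j whose coefficients c are orthogonal to every row
  -- (λ j → genP j q) of the P-part, so the complement of the rows spans it.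
  contraction-span : Σ ℕ λ t → Σ (Fin t → QVec s) λ u →
                     (∀ i → InContrS V (u i)) × (∀ y → InContrS V y → InSpan u y)
  contraction-span = k , u , u∈ , spans
    where
    rows : Fin p → QVec k
    rows q j = genP j q
    ρ : Fin k → QVec k
    ρ = proj₁ (complement rows)
    u : Fin k → QVec s
    u j = comb (ρ j) genS
    u∈ : ∀ j → InContrS V (u j)
    u∈ j = ρ j , ≋-refl , λ q → sym (proj₁ (proj₂ (complement rows)) j q)
    spans : ∀ y → InContrS V y → InSpan u y
    spans y (c , y≋ , 0≋) =
      c , ≋-trans y≋ (≋-trans (comb-congᶜ c≋ genS) (≋-sym (comb-comb c ρ genS)))
      where
      c≋ : c ≋ comb c ρ
      c≋ = proj₂ (proj₂ (complement rows)) c (λ q → sym (0≋ q))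

generator∈lattice : ∀ {n m} (g : Fin m → QVec n) (j : Fin m) → InLattice g (g j)
generator∈lattice g j = δℤ j , ≋-sym (comb-δ j g)

module _ {s p k m : ℕ} (V : VSpace s p k) (lP : Fin m → QVec p) where

  -- Lifts of the generators of L_P into V, with S-parts orthogonal to V×S:
  -- lift each generator arbitrarily, then subtract the orthogonal projection
  -- of its S-part onto V×S, which keeps it in V.
  orthogonal-lifts : (∀ h → InLattice lP h → InRestrP V h) →
                     Σ (Fin m → QVec s) λ lS → (∀ j → InV V (lS j) (lP j))
                                             × (∀ j y → InContrS V y → dot (lS j) y ≡ 0ℚ)
  orthogonal-lifts lift with contraction-span V
  ... | t , u , u∈ , u-spans = lS , lS∈V , lS⊥
    where
    lifted : ∀ j → InRestrP V (lP j)
    lifted j = lift (lP j) (generator∈lattice lP j)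

    projected : ∀ j → Σ (QVec s) λ w → InSpan u w × (∀ i → dot (proj₁ (lifted j) ⊖ w) (u i) ≡ 0ℚ)
    projected j = project u (proj₁ (lifted j))

    lS : Fin m → QVec s
    lS j = proj₁ (lifted j) ⊖ proj₁ (projected j)

    lS∈V : ∀ j → InV V (lS j) (lP j)
    lS∈V j = InV-cong V ≋-refl (λ i → +-identityʳ (lP j i))
      (InV-⊖ V (proj₂ (lifted j)) (InContrS-span V u u∈ (proj₁ (proj₂ (projected j)))))

    lS⊥ : ∀ j y → InContrS V y → dot (lS j) y ≡ 0ℚ
    lS⊥ j y y∈ = ⊥-span (lS j) u (proj₂ (proj₂ (projected j))) (u-spans y y∈)

  module _ (lS : Fin m → QVec s) (lS∈V : ∀ j → InV V (lS j) (lP j)) where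

    lattice-lift : (c : Fin m → ℤ) → InV V (comb (λ j → ℤ→ℚ (c j)) lS) (comb (λ j → ℤ→ℚ (c j)) lP)
    lattice-lift c = InV-comb V lS lP lS∈V (λ j → ℤ→ℚ (c j))

    matched⊆ : (f : QVec s) → InMatched V lP f →
               ∃ λ (g : QVec s) → ∃ λ (h : QVec s) → InContrS V g × InLattice lS h × (f ≋ (g ⊕ h))
    matched⊆ f (hP , (c , hP≋) , f∈V) = f ⊖ h , h , g∈ , (c , ≋-refl) , f≋
      where
      h  = comb (λ j → ℤ→ℚ (c j)) lS
      hL = comb (λ j → ℤ→ℚ (c j)) lP
      g∈ : InContrS V (f ⊖ h)
      g∈ = InV-cong V ≋-refl (λ i → trans (cong (_- hL i) (hP≋ i)) (+-inverseʳ (hL i)))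
                     (InV-⊖ V f∈V (lattice-lift c))
      f≋ : f ≋ ((f ⊖ h) ⊕ h)
      f≋ i = solve 2 (λ a b → a := (a :- b) :+ b) refl (f i) (h i)

    matched⊇ : (f g h : QVec s) → InContrS V g → InLattice lS h → f ≋ (g ⊕ h) → InMatched V lP f
    matched⊇ f g h g∈ (c , h≋) f≋ = comb (λ j → ℤ→ℚ (c j)) lP , (c , ≋-refl) , f∈V
      where
      f∈V : InV V f (comb (λ j → ℤ→ℚ (c j)) lP)
      f∈V = InV-cong V (λ i → sym (trans (f≋ i) (cong (g i +_) (h≋ i)))) (λ i → +-identityˡ _)
                     (InV-⊕ V g∈ (lattice-lift c))

-- Lemma 12: K_S = V×S + L_S with L_S ⊥ V×S, where L_S is generated by the
-- orthogonal lifts of the generators of L_P.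
lemma12 : (s p k m : ℕ) (V : VSpace s p k) (lP : Fin m → QVec p)
  → (∀ h → InLattice lP h → InRestrP V h)
  → (∀ h → InContrP V h → InSpan lP h)
  → Σ ℕ λ m' → Σ (Fin m' → QVec s) λ lS
    → ((x y : QVec s) → InLattice lS x → InContrS V y → dot x y ≡ 0ℚ)
    × ((f : QVec s) → InMatched V lP f
         → ∃ λ (g : QVec s) → ∃ λ (h : QVec s) → InContrS V g × InLattice lS h × (f ≋ (g ⊕ h)))
    × ((f g h : QVec s) → InContrS V g → InLattice lS h → f ≋ (g ⊕ h) → InMatched V lP f)
lemma12 s p k m V lP lift _ = m , lS , lattice⊥ , matched⊆ V lP lS lS∈V , matched⊇ V lP lS lS∈V
  where
  lS : Fin m → QVec s
  lS = proj₁ (orthogonal-lifts V lP lift)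
  lS∈V : ∀ j → InV V (lS j) (lP j)
  lS∈V = proj₁ (proj₂ (orthogonal-lifts V lP lift))
  lS⊥ : ∀ j y → InContrS V y → dot (lS j) y ≡ 0ℚ
  lS⊥ = proj₂ (proj₂ (orthogonal-lifts V lP lift))

  lattice⊥ : (x y : QVec s) → InLattice lS x → InContrS V y → dot x y ≡ 0ℚ
  lattice⊥ x y (c , x≋) y∈ =
    trans (dot-congˡ x≋ y) (comb-⊥ lS y (λ j → lS⊥ j y y∈) (λ j → ℤ→ℚ (c j)))
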